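{- Let $G$ be a graph. Then $\mathrm{sg_e}(G) = n(G)$ if and only if every vertex of $G$ has a dominant neighbor.
   Context: All graphs are finite and simple; $n(G)=|V(G)|$. For a graph $G$, a set $S\subseteq V(G)$ is a strong edge geodetic set if to each (unordered) pair of vertices $x,y\in S$ one can assign one shortest $x,y$-path (or no path) such that every edge of $G$ lies on at least one of the assigned paths; $\mathrm{sg_e}(G)$ is the minimum cardinality of such a set. $N[u]=\{u\}\cup\{x : ux\in E(G)\}$. A vertex $v$ is a dominant neighbor of $u$ if $uv\in E(G)$ and $N[u]\subseteq N[v]$. -}

module Defs where

open import Data.Nat using (ℕ; zero; suc; _≤_)
open import Data.Fin using (Fin; _<_)
open import Data.Fin.Subset using (Subset; _∈_; ∣_∣)
open import Data.Maybe using (Maybe; just)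
open import Data.Product using (Σ; ∃; _×_; _,_)
open import Data.Sum using (_⊎_)
open import Relation.Nullary using (¬_)
open import Relation.Binary.PropositionalEquality using (_≡_)
open import Relation.Binary.Definitions using (Decidable)
open import Function.Bundles using (_⇔_)

-- A finite simple graph on vertex set Fin n (so n(G) = n):
-- symmetric, irreflexive, decidable adjacency.
record Graph (n : ℕ) : Set₁ where
  field
    Adj    : Fin n → Fin n → Set
    sym    : ∀ {u v} → Adj u v → Adj v u
    irrefl : ∀ {u} → ¬ Adj u u
    adj?   : Decidable Adj

module _ {n : ℕ} (G : Graph n) where
  open Graph G

  data Walk : Fin n → Fin n → ℕ → Set where
    here : ∀ {x} → Walk x x zero
    step : ∀ {x y z k} → Adj x y → Walk y z k → Walk x z (suc k)

  -- a shortest x,y-path: an x,y-walk of length k with no x,y-walk shorter than k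
  -- (a minimum-length walk is necessarily a path)
  record ShortestPath (x y : Fin n) : Set where
    constructor mkSP
    field
      len      : ℕ
      walk     : Walk x y len
      shortest : ∀ {k} → Walk x y k → len ≤ k

  data EdgeOnWalk (u v : Fin n) : ∀ {x y k} → Walk x y k → Set where
    on-here  : ∀ {y z k} (a : Adj u y) (w : Walk y z k) → y ≡ v → EdgeOnWalk u v (step a w)
    on-here' : ∀ {y z k} (a : Adj v y) (w : Walk y z k) → y ≡ u → EdgeOnWalk u v (step a w)
    on-there : ∀ {x y z k} (a : Adj x y) {w : Walk y z k} → EdgeOnWalk u v w → EdgeOnWalk u v (step a w)

  EdgeOn : (u v : Fin n) → ∀ {x y} → ShortestPath x y → Set
  EdgeOn u v p = EdgeOnWalk u v (ShortestPath.walk p)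

  -- S is a strong edge geodetic set: to each unordered pair {x,y} ⊆ S (represented
  -- by x < y) one assigns one shortest x,y-path or no path, so that every edge of G
  -- lies on at least one assigned path.
  IsStrongEdgeGeodetic : Subset n → Set
  IsStrongEdgeGeodetic S =
    Σ ((x y : Fin n) → x ∈ S → y ∈ S → x < y → Maybe (ShortestPath x y)) λ assign →
      ∀ u v → Adj u v →
        Σ (Fin n) λ x → Σ (Fin n) λ y → Σ (x ∈ S) λ hx → Σ (y ∈ S) λ hy → Σ (x < y) λ lt →
          Σ (ShortestPath x y) λ p → (assign x y hx hy lt ≡ just p) × EdgeOn u v p

  SgeIs : ℕ → Set
  SgeIs k = (Σ (Subset n) λ S → IsStrongEdgeGeodetic S × ∣ S ∣ ≡ k)
          × (∀ S → IsStrongEdgeGeodetic S → k ≤ ∣ S ∣)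

  InClosedNbhd : Fin n → Fin n → Set
  InClosedNbhd u w = w ≡ u ⊎ Adj u w

  IsDominantNeighbor : Fin n → Fin n → Set
  IsDominantNeighbor u v = Adj u v × (∀ w → InClosedNbhd u w → InClosedNbhd v w)

-- A vertex u with a dominant neighbour v lies in every strong edge geodetic set:
-- a shortest path through the edge uv that has u as an inner vertex enters or
-- leaves u via v, and the other path-neighbour of u is in N[u] ⊆ N[v], so u can
-- be bypassed, contradicting minimality. Conversely, if u has no dominant
-- neighbour then V(G) − u is strong edge geodetic: every edge avoiding u is its
-- own geodesic, and each edge uv lies on the geodesic v u w, where w ∈ N(u) is
-- a vertex outside N[v].
module Submission where

open import Defs
open import Data.Nat using (ℕ; suc; _≤_; z≤n; s≤s) renaming (_<_ to _<ℕ_)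
open import Data.Nat.Properties using (n<1+n; m<n⇒m<1+n; <⇒≱; module ≤-Reasoning)
open import Data.Fin using (Fin; _<_)
open import Data.Fin.Properties using (_≟_; <-cmp; <⇒≢; any?; all?; ¬∀⟶∃¬)
open import Data.Fin.Subset using (Subset; _∈_; ∣_∣; ⊤; _-_)
open import Data.Fin.Subset.Properties using (∈⊤; ∣⊤∣≡n; p⊆q⇒∣p∣≤∣q∣; x∈p∧x≢y⇒x∈p-y; x∈p⇒∣p-x∣<∣p∣)
open import Data.Maybe using (Maybe; just; nothing)
open import Data.Product using (Σ; ∃; _×_; _,_; proj₂)
open import Data.Sum using (_⊎_; inj₁; inj₂; map₂)
open import Data.Empty using (⊥-elim)
open import Function using (_∘_)
open import Function.Bundles using (_⇔_; mk⇔)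
open import Relation.Binary.Definitions using (Decidable; tri<; tri≈; tri>)
open import Relation.Binary.PropositionalEquality using (_≡_; _≢_; refl; ≢-sym; subst)
open import Relation.Nullary using (¬_; Dec; yes; no)
open import Relation.Nullary.Decidable using (_→-dec_; _×-dec_; _⊎-dec_)

module _ {n : ℕ} (G : Graph n) where
  open Graph G

  private
    variable
      x y z u v c : Fin n
      k : ℕ
      S : Subset n

  N[_]⊆N[_] : Fin n → Fin n → Set
  N[ u ]⊆N[ v ] = ∀ w → InClosedNbhd G u w → InClosedNbhd G v w

  closedNbhd-sym : InClosedNbhd G x y → InClosedNbhd G y x
  closedNbhd-sym (inj₁ refl) = inj₁ refl
  closedNbhd-sym (inj₂ xy)   = inj₂ (sym xy)

  closedNbhd? : Decidable (InClosedNbhd G)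
  closedNbhd? u w = w ≟ u ⊎-dec adj? u w

  N⊆N? : Decidable N[_]⊆N[_]
  N⊆N? u v = all? λ w → closedNbhd? u w →-dec closedNbhd? v w

  dominantNeighbor? : Decidable (IsDominantNeighbor G)
  dominantNeighbor? u v = adj? u v ×-dec N⊆N? u v

  ¬N⊆N⇒escape : Adj u v → ¬ N[ u ]⊆N[ v ] → ∃ λ w → Adj u w × w ≢ v × ¬ Adj v w
  ¬N⊆N⇒escape {u = u} {v = v} uv ¬⊆ with ¬∀⟶∃¬ n _ (λ w → closedNbhd? u w →-dec closedNbhd? v w) ¬⊆
  ... | w , ¬u→v with closedNbhd? u w
  ...   | no w∉N[u]        = ⊥-elim (¬u→v (⊥-elim ∘ w∉N[u]))
  ...   | yes (inj₁ refl) = ⊥-elim (¬u→v λ _ → inj₂ (sym uv))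
  ...   | yes (inj₂ uw)   = w , uw , (λ w≡v → ¬u→v λ _ → inj₁ w≡v) , (λ vw → ¬u→v λ _ → inj₂ vw)

  Shortcut : Fin n → Fin n → ℕ → Set
  Shortcut x z k = ∃ λ j → j <ℕ k × Walk G x z j

  shortcut-step : Adj x y → Shortcut y z k → Shortcut x z (suc k)
  shortcut-step xy (j , j<k , w) = suc j , s≤s j<k , step xy w

  shortcut-closedNbhd : InClosedNbhd G x y → Walk G y z k → Shortcut x z (suc (suc k))
  shortcut-closedNbhd {k = k} (inj₁ refl) w = k , m<n⇒m<1+n (n<1+n k) , w
  shortcut-closedNbhd {k = k} (inj₂ xy)   w = suc k , n<1+n (suc k) , step xy w

  module _ (N[u]⊆N[v] : N[ u ]⊆N[ v ]) where

    -- a walk v, u, … to z can bypass u unless u = z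
    shortcut-from-dominant : Walk G u z k → u ≡ z ⊎ Shortcut v z (suc k)
    shortcut-from-dominant here        = inj₁ refl
    shortcut-from-dominant (step uy w) = inj₂ (shortcut-closedNbhd (N[u]⊆N[v] _ (inj₂ uy)) w)

    shortcut-after-step : Adj x y → {w : Walk G y z k} → EdgeOnWalk G u v w →
                          u ≡ z ⊎ Shortcut x z (suc k)
    shortcut-after-step xu (on-here _ w refl) =
      inj₂ (shortcut-closedNbhd (closedNbhd-sym (N[u]⊆N[v] _ (inj₂ (sym xu)))) w)
    shortcut-after-step xv (on-here' _ w refl) = map₂ (shortcut-step xv) (shortcut-from-dominant w)
    shortcut-after-step xy (on-there yz e)    = map₂ (shortcut-step xy) (shortcut-after-step yz e)

    shortcut-dominated-edge : {w : Walk G x z k} → EdgeOnWalk G u v w →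
                              u ≡ x ⊎ u ≡ z ⊎ Shortcut x z k
    shortcut-dominated-edge (on-here _ _ _)     = inj₁ refl
    shortcut-dominated-edge (on-here' _ w refl) = inj₂ (shortcut-from-dominant w)
    shortcut-dominated-edge (on-there xy e)     = inj₂ (shortcut-after-step xy e)

    dominated-endpoint : (p : ShortestPath G x y) → EdgeOn G u v p → u ≡ x ⊎ u ≡ y
    dominated-endpoint p e with shortcut-dominated-edge e
    ... | inj₁ u≡x                    = inj₁ u≡x
    ... | inj₂ (inj₁ u≡y)             = inj₂ u≡y
    ... | inj₂ (inj₂ (j , j<len , w)) = ⊥-elim (<⇒≱ j<len (ShortestPath.shortest p w))

  dominated∈strongEdgeGeodetic : IsDominantNeighbor G u v → IsStrongEdgeGeodetic G S → u ∈ S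
  dominated∈strongEdgeGeodetic {u = u} {v = v} (uv , N[u]⊆N[v]) (_ , cover) with cover u v uv
  ... | _ , _ , x∈S , y∈S , _ , p , _ , e with dominated-endpoint N[u]⊆N[v] p e
  ...   | inj₁ refl = x∈S
  ...   | inj₂ refl = y∈S

  edgePath : Adj x y → ShortestPath G x y
  edgePath {x = x} {y = y} xy = mkSP 1 (step xy here) shortest
    where
    shortest : ∀ {k} → Walk G x y k → 1 ≤ k
    shortest here       = ⊥-elim (irrefl xy)
    shortest (step _ _) = s≤s z≤n

  twoPath : Adj x c → Adj c y → ¬ Adj x y → x ≢ y → ShortestPath G x y
  twoPath {x = x} {c = c} {y = y} xc cy ¬xy x≢y = mkSP 2 (step xc (step cy here)) shortest
    where
    shortest : ∀ {k} → Walk G x y k → 2 ≤ k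
    shortest here                = ⊥-elim (x≢y refl)
    shortest (step xy here)      = ⊥-elim (¬xy xy)
    shortest (step _ (step _ _)) = s≤s (s≤s z≤n)

  edgeOnWalk-sym : {w : Walk G x y k} → EdgeOnWalk G u v w → EdgeOnWalk G v u w
  edgeOnWalk-sym (on-here a w eq)  = on-here' a w eq
  edgeOnWalk-sym (on-here' a w eq) = on-here a w eq
  edgeOnWalk-sym (on-there a e)    = on-there a (edgeOnWalk-sym e)

  Route : Set
  Route = ∀ x y → x < y → Maybe (ShortestPath G x y)

  CoveredBy : Subset n → Route → Fin n → Fin n → Set
  CoveredBy S route u v =
    Σ (Fin n) λ x → Σ (Fin n) λ y → Σ (x ∈ S) λ _ → Σ (y ∈ S) λ _ → Σ (x < y) λ x<y →
      Σ (ShortestPath G x y) λ p → (route x y x<y ≡ just p) × EdgeOn G u v p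

  coveredBy-sym : ∀ {route} → CoveredBy S route u v → CoveredBy S route v u
  coveredBy-sym (x , y , x∈S , y∈S , x<y , p , eq , e) = x , y , x∈S , y∈S , x<y , p , eq , edgeOnWalk-sym e

  strongEdgeGeodetic : (route : Route) → (∀ {u v} → Adj u v → CoveredBy S route u v) →
                       IsStrongEdgeGeodetic G S
  strongEdgeGeodetic route cover = (λ x y _ _ → route x y) , λ _ _ → cover

  edgeRoute : (∀ x y → x < y → ¬ Adj x y → Maybe (ShortestPath G x y)) → Route
  edgeRoute detour x y x<y = edgeOrDetour (adj? x y)
    where
    edgeOrDetour : Dec (Adj x y) → Maybe (ShortestPath G x y)
    edgeOrDetour (yes xy)  = just (edgePath xy)
    edgeOrDetour (no ¬xy) = detour x y x<y ¬xy

  edgeRoute-covers : ∀ detour (x<y : x < y) → Adj x y →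
                     Σ (ShortestPath G x y) λ p → (edgeRoute detour x y x<y ≡ just p) × EdgeOn G x y p
  edgeRoute-covers {x = x} {y = y} _ _ xy with adj? x y
  ... | yes xy′ = edgePath xy′ , refl , on-here xy′ here refl
  ... | no ¬xy  = ⊥-elim (¬xy xy)

  coveredBy-edge : ∀ {detour} → x ∈ S → y ∈ S → Adj x y → CoveredBy S (edgeRoute detour) x y
  coveredBy-edge {x = x} {y = y} {detour = detour} x∈S y∈S xy with <-cmp x y
  ... | tri< x<y _ _ = let p , eq , e = edgeRoute-covers detour x<y xy in
                       x , y , x∈S , y∈S , x<y , p , eq , e
  ... | tri≈ _ refl _ = ⊥-elim (irrefl xy)
  ... | tri> _ _ y<x = let p , eq , e = edgeRoute-covers detour y<x (sym xy) in
                       y , x , y∈S , x∈S , y<x , p , eq , edgeOnWalk-sym e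

  hubRoute : Fin n → ∀ x y → x < y → ¬ Adj x y → Maybe (ShortestPath G x y)
  hubRoute c x y x<y ¬xy = viaHub (adj? c x) (adj? c y)
    where
    viaHub : Dec (Adj c x) → Dec (Adj c y) → Maybe (ShortestPath G x y)
    viaHub (yes cx) (yes cy) = just (twoPath (sym cx) cy ¬xy (<⇒≢ x<y))
    viaHub _        _        = nothing

  hubRoute-covers : (x<y : x < y) → Adj c x → Adj c y → ¬ Adj x y →
                    Σ (ShortestPath G x y) λ p → (edgeRoute (hubRoute c) x y x<y ≡ just p)
                      × EdgeOn G c x p × EdgeOn G c y p
  hubRoute-covers {x = x} {y = y} {c = c} x<y cx cy ¬xy with adj? x y
  ... | yes xy  = ⊥-elim (¬xy xy)
  ... | no ¬xy′ with adj? c x | adj? c y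
  ...   | no ¬cx  | _       = ⊥-elim (¬cx cx)
  ...   | yes _   | no ¬cy  = ⊥-elim (¬cy cy)
  ...   | yes cx′ | yes cy′ =
    twoPath (sym cx′) cy′ ¬xy′ (<⇒≢ x<y) , refl ,
    on-here' (sym cx′) _ refl , on-there (sym cx′) (on-here cy′ here refl)

  coveredBy-hub : x ∈ S → y ∈ S → Adj c x → Adj c y → ¬ Adj x y → x ≢ y →
                  CoveredBy S (edgeRoute (hubRoute c)) c x
  coveredBy-hub {x = x} {y = y} x∈S y∈S cx cy ¬xy x≢y with <-cmp x y
  ... | tri< x<y _ _ = let p , eq , e , _ = hubRoute-covers x<y cx cy ¬xy in
                       x , y , x∈S , y∈S , x<y , p , eq , e
  ... | tri≈ _ x≡y _ = ⊥-elim (x≢y x≡y)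
  ... | tri> _ _ y<x = let p , eq , _ , e = hubRoute-covers y<x cy cx (¬xy ∘ sym) in
                       y , x , y∈S , x∈S , y<x , p , eq , e

  ⊤-isStrongEdgeGeodetic : IsStrongEdgeGeodetic G ⊤
  ⊤-isStrongEdgeGeodetic = strongEdgeGeodetic (edgeRoute noDetour) (coveredBy-edge ∈⊤ ∈⊤)
    where
    noDetour : ∀ x y → x < y → ¬ Adj x y → Maybe (ShortestPath G x y)
    noDetour _ _ _ _ = nothing

  ⊤-c-isStrongEdgeGeodetic : (∀ {v} → Adj c v → ∃ λ w → Adj c w × w ≢ v × ¬ Adj v w) →
                             IsStrongEdgeGeodetic G (⊤ - c)
  ⊤-c-isStrongEdgeGeodetic {c = c} escape = strongEdgeGeodetic (edgeRoute (hubRoute c)) cover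
    where
    ∈⊤-c : x ≢ c → x ∈ ⊤ - c
    ∈⊤-c = x∈p∧x≢y⇒x∈p-y ∈⊤

    neighbour∈⊤-c : Adj c x → x ∈ ⊤ - c
    neighbour∈⊤-c cx = ∈⊤-c λ { refl → irrefl cx }

    hubEdge : Adj c v → CoveredBy (⊤ - c) (edgeRoute (hubRoute c)) c v
    hubEdge cv with escape cv
    ... | w , cw , w≢v , ¬vw = coveredBy-hub (neighbour∈⊤-c cv) (neighbour∈⊤-c cw) cv cw ¬vw (≢-sym w≢v)

    cover : Adj u v → CoveredBy (⊤ - c) (edgeRoute (hubRoute c)) u v
    cover {u} {v} uv with u ≟ c | v ≟ c
    ... | yes refl | _        = hubEdge uv
    ... | no _     | yes refl = coveredBy-sym (hubEdge (sym uv))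
    ... | no u≢c   | no v≢c   = coveredBy-edge (∈⊤-c u≢c) (∈⊤-c v≢c) uv

  allDominated⇒sgeIs-n : (∀ u → ∃ λ v → IsDominantNeighbor G u v) → SgeIs G n
  allDominated⇒sgeIs-n dominant = (⊤ , ⊤-isStrongEdgeGeodetic , ∣⊤∣≡n n) , minimal
    where
    open ≤-Reasoning
    minimal : ∀ S → IsStrongEdgeGeodetic G S → n ≤ ∣ S ∣
    minimal S isSEG = begin
      n          ≡⟨ ∣⊤∣≡n n ⟨
      ∣ ⊤ {n} ∣  ≤⟨ p⊆q⇒∣p∣≤∣q∣ {p = ⊤} (λ {u} _ → dominated∈strongEdgeGeodetic (proj₂ (dominant u)) isSEG) ⟩
      ∣ S ∣      ∎

  sgeIs-n⇒allDominated : SgeIs G n → ∀ u → ∃ λ v → IsDominantNeighbor G u v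
  sgeIs-n⇒allDominated (_ , minimal) u with any? (dominantNeighbor? u)
  ... | yes dominant = dominant
  ... | no ¬dominant = ⊥-elim (<⇒≱ ∣⊤-u∣<n (minimal (⊤ - u) (⊤-c-isStrongEdgeGeodetic escape)))
    where
    escape : Adj u v → ∃ λ w → Adj u w × w ≢ v × ¬ Adj v w
    escape {v} uv = ¬N⊆N⇒escape uv λ N[u]⊆N[v] → ¬dominant (v , uv , N[u]⊆N[v])

    ∣⊤-u∣<n : ∣ ⊤ - u ∣ <ℕ n
    ∣⊤-u∣<n = subst (∣ ⊤ - u ∣ <ℕ_) (∣⊤∣≡n n) (x∈p⇒∣p-x∣<∣p∣ {p = ⊤ {n}} ∈⊤)

proposition3p2 : ∀ {n : ℕ} (G : Graph n) →
    SgeIs G n ⇔ (∀ (u : Fin n) → ∃ λ v → IsDominantNeighbor G u v)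
proposition3p2 G = mk⇔ (sgeIs-n⇒allDominated G) (allDominated⇒sgeIs-n G)
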